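{- Let $\pi$ be an $\mathsf{MLL}^-$ proof net, and let $A$, $A'$, $B$, $B'$ be subformula occurrences appearing in $\pi$ such that $A$ and $B$ are distinct, $A'$ is an immediate subformula of $A$, and $B'$ is an immediate subformula of $B$. Suppose that $B'\in eA'$. Then $B\notin eA'$ if and only if $A\in kB$.
   Context: $\mathsf{MLL}^-$ formulas: over atoms $a,a^\perp$, $F ::= a\mid a^\perp\mid F\wp F\mid F\otimes F$ ($\wp$ = par), negation $a^{\perp\perp}=a$, $(A\otimes B)^\perp=B^\perp\wp A^\perp$, $(A\wp B)^\perp=B^\perp\otimes A^\perp$. A pre-proof net: finite list of formula trees, finitely many cuts (trees with root $A\oslash A^\perp$, children the trees of $A$, $A^\perp$), and a perfect matching (linking) of all leaves pairing occurrences of $a$ with occurrences of $a^\perp$; viewed as a graph with tree and linking edges. A switching deletes, for each $\wp$-node, one of its two child edges; correct (= proof net) means all switchings connected and acyclic. $\sigma$ is a subprenet of $\pi$ if all formulas/cuts of $\sigma$ are subformula/cut occurrences of $\pi$ and its linking is the restriction of $\pi$'s; a subnet is a subprenet with $\sigma$ and $\pi$ both correct; a door of $\sigma$ is a conclusion (root) of $\sigma$. For a subformula/cut occurrence $A$ in a proof net $\pi$, the kingdom $kA$ is the smallest subnet of $\pi$ having $A$ as a door, and the empire $eA$ is the largest subnet of $\pi$ having $A$ as a door (with respect to inclusion; these exist). -}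

module Defs where

open import Data.Nat using (ℕ; _≤_)
open import Data.Bool using (Bool; true; false; T)
open import Data.Fin using (Fin)
open import Data.List using (List; []; _∷_; length; lookup; _++_; [_])
open import Data.Product using (Σ; _×_; _,_; proj₁; proj₂)
open import Data.Sum using (_⊎_)
open import Data.Empty using (⊥)
open import Data.Unit using (⊤)
open import Relation.Nullary using (¬_)
open import Relation.Binary.PropositionalEquality using (_≡_; _≢_)
open import Data.List.Relation.Unary.Linked using (Linked)
open import Data.List.Relation.Unary.AllPairs using (AllPairs)
open import Relation.Binary.Construct.Closure.ReflexiveTransitive using (Star)

Atom : Set
Atom = ℕ

data Conn : Set where
  tens par : Conn

data Formula : Set where
  atm  : Atom → Formula
  atm⊥ : Atom → Formula
  bin  : Conn → Formula → Formula → Formula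

_⊥' : Formula → Formula
atm a ⊥' = atm⊥ a
atm⊥ a ⊥' = atm a
bin tens A B ⊥' = bin par (B ⊥') (A ⊥')
bin par A B ⊥' = bin tens (B ⊥') (A ⊥')

data Side : Set where
  L R : Side

-- positions (subformula occurrences) inside a formula tree
data Pos : Formula → Set where
  here : ∀ {F} → Pos F
  inl  : ∀ {c A B} → Pos A → Pos (bin c A B)
  inr  : ∀ {c A B} → Pos B → Pos (bin c A B)

subAt : ∀ {F} → Pos F → Formula
subAt {F} here = F
subAt (inl p) = subAt p
subAt (inr p) = subAt p

data ChildP : ∀ {F} → Side → Pos F → Pos F → Set where
  cl : ∀ {c A B} → ChildP {bin c A B} L here (inl here)
  cr : ∀ {c A B} → ChildP {bin c A B} R here (inr here)
  sl : ∀ {c A B s} {p q : Pos A} → ChildP s p q → ChildP {bin c A B} s (inl p) (inl q)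
  sr : ∀ {c A B s} {p q : Pos B} → ChildP s p q → ChildP {bin c A B} s (inr p) (inr q)

data Root : Set where
  concl : Formula → Root
  cut   : Formula → Root   -- a cut A ⊘ A^⊥ (children: A and A^⊥)

data RPos : Root → Set where
  cpos    : ∀ {F} → Pos F → RPos (concl F)
  cutNode : ∀ {F} → RPos (cut F)
  cutL    : ∀ {F} → Pos F → RPos (cut F)
  cutR    : ∀ {F} → Pos (F ⊥') → RPos (cut F)

data Label : Set where
  cutLab : Label
  fm     : Formula → Label

labelR : ∀ {r} → RPos r → Label
labelR (cpos p) = fm (subAt p)
labelR cutNode = cutLab
labelR (cutL p) = fm (subAt p)
labelR (cutR p) = fm (subAt p)

data ChildR : ∀ {r} → Side → RPos r → RPos r → Set where
  inC   : ∀ {F s} {p q : Pos F} → ChildP s p q → ChildR s (cpos p) (cpos q)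
  cutCL : ∀ {F} → ChildR {cut F} L cutNode (cutL here)
  cutCR : ∀ {F} → ChildR {cut F} R cutNode (cutR here)
  inCL  : ∀ {F s} {p q : Pos F} → ChildP s p q → ChildR s (cutL p) (cutL q)
  inCR  : ∀ {F s} {p q : Pos (F ⊥')} → ChildP s p q → ChildR s (cutR p) (cutR q)

Node : List Root → Set
Node rs = Σ (Fin (length rs)) (λ i → RPos (lookup rs i))

label : ∀ (rs : List Root) → Node rs → Label
label rs (i , p) = labelR p

data Child (rs : List Root) : Side → Node rs → Node rs → Set where
  child : ∀ {s i} {p q : RPos (lookup rs i)} → ChildR s p q → Child rs s (i , p) (i , q)

IsAtomic : Label → Set
IsAtomic (fm (atm _)) = ⊤
IsAtomic (fm (atm⊥ _)) = ⊤
IsAtomic _ = ⊥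

IsPar : Label → Set
IsPar (fm (bin par _ _)) = ⊤
IsPar _ = ⊥

IsFm : Label → Set
IsFm (fm _) = ⊤
IsFm cutLab = ⊥

negLab : Label → Label
negLab cutLab = cutLab
negLab (fm F) = fm (F ⊥')

Leaf : List Root → Set
Leaf rs = Σ (Node rs) (λ x → IsAtomic (label rs x))

-- pre-proof net: formula trees and cuts, plus a linking = perfect matching
-- of the leaves (fixed-point-free involution) pairing a with a^⊥
record PreNet : Set where
  field
    roots      : List Root
    link       : Leaf roots → Leaf roots
    link-invol : ∀ l → link (link l) ≡ l
    link-dual  : ∀ l → label roots (proj₁ (link l)) ≡ negLab (label roots (proj₁ l))

module _ (π : PreNet) where
  open PreNet π

  NodeOf : Set
  NodeOf = Node roots

  lab : NodeOf → Label
  lab = label roots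

  Ch : Side → NodeOf → NodeOf → Set
  Ch = Child roots

  Subset : Set
  Subset = NodeOf → Bool

  _∈ₛ_ : NodeOf → Subset → Set
  x ∈ₛ S = T (S x)

  _⊆ₛ_ : Subset → Subset → Set
  S ⊆ₛ S' = ∀ x → x ∈ₛ S → x ∈ₛ S'

  full : Subset
  full _ = true

  -- a switching chooses, for each ⅋-node, the side of the child edge to delete
  Switching : Set
  Switching = NodeOf → Side

  TreeEdge : Subset → Switching → NodeOf → NodeOf → Set
  TreeEdge S sw x y = Σ Side λ s → Ch s x y × x ∈ₛ S × y ∈ₛ S × (IsPar (lab x) → sw x ≢ s)

  LinkEdge : Subset → NodeOf → NodeOf → Set
  LinkEdge S x y = Σ (Leaf roots) λ l → proj₁ l ≡ x × proj₁ (link l) ≡ y × x ∈ₛ S × y ∈ₛ S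

  DEdge : Subset → Switching → NodeOf → NodeOf → Set
  DEdge S sw x y = TreeEdge S sw x y ⊎ LinkEdge S x y

  Edge : Subset → Switching → NodeOf → NodeOf → Set
  Edge S sw x y = DEdge S sw x y ⊎ DEdge S sw y x

  Connected : Subset → Switching → Set
  Connected S sw = ∀ x y → x ∈ₛ S → y ∈ₛ S → Star (Edge S sw) x y

  -- a cycle: distinct vertices x, w₁, …, wₖ (k ≥ 2), consecutive ones adjacent,
  -- and wₖ adjacent to x  (the graph is simple, so this is the notion of cycle)
  HasCycle : Subset → Switching → Set
  HasCycle S sw = Σ NodeOf λ x → Σ (List NodeOf) λ ws →
    (2 ≤ length ws) × AllPairs _≢_ (x ∷ ws) × Linked (Edge S sw) (x ∷ ws ++ [ x ])

  Correct : Subset → Set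
  Correct S = ∀ (sw : Switching) → Connected S sw × ¬ HasCycle S sw

  -- S is (the node set of) a subprenet: full formula subtrees, full cuts,
  -- and the linking restricts to S
  Subprenet : Subset → Set
  Subprenet S = (∀ s x y → Ch s x y → x ∈ₛ S → y ∈ₛ S)
              × (∀ (l : Leaf roots) → proj₁ l ∈ₛ S → proj₁ (link l) ∈ₛ S)

  Subnet : Subset → Set
  Subnet S = Subprenet S × Correct S × Correct full

  Door : Subset → NodeOf → Set
  Door S x = x ∈ₛ S × IsFm (lab x) × (∀ s y → Ch s y x → ¬ (y ∈ₛ S))

  IsKingdom : NodeOf → Subset → Set
  IsKingdom A S = Subnet S × Door S A × (∀ S' → Subnet S' → Door S' A → S ⊆ₛ S')

  IsEmpire : NodeOf → Subset → Set
  IsEmpire A S = Subnet S × Door S A × (∀ S' → Subnet S' → Door S' A → S' ⊆ₛ S)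

  ImmSub : NodeOf → NodeOf → Set
  ImmSub A' A = Σ Side λ s → Ch s A A'

-- Subnets of a proof net are closed under intersection, and under union when they
-- overlap; both facts rest on the uniqueness of simple paths in an acyclic switching
-- graph. Hence kB lies inside every subnet containing B, and a subnet meeting eA'
-- but not containing the parent A of A' can be merged into eA'. If B ∈ eA' then
-- kB ⊆ eA', so A ∈ kB would put the parent of the door A' inside eA'. If A ∉ kB,
-- then kB meets eA' in B' and avoids A, so kB ⊆ eA' and in particular B ∈ eA'.
module Submission where

open import Defs
open import Data.Bool using (T?; _∧_; _∨_)
open import Data.Bool.Properties using (T-∧; T-∨)
import Data.Fin.Properties as Fin
open import Data.Nat using (_≤_; s≤s; z≤n)
open import Data.List using (List; []; _∷_; length; _++_; [_])
open import Data.List.Relation.Unary.AllPairs using (AllPairs; []; _∷_)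
open import Data.List.Relation.Unary.All using (All; []; _∷_)
import Data.List.Relation.Unary.Linked as Linked
open Linked using (Linked; [-]; _∷_)
open import Data.Product using (Σ; _×_; _,_; proj₁; proj₂) renaming (map to map×)
open import Data.Product.Properties using (≡-dec)
open import Data.Sum using (_⊎_; inj₁; inj₂; swap) renaming (map to map⊎; [_,_] to [_,_]′)
open import Data.Empty using (⊥-elim)
open import Data.Unit using (⊤; tt)
open import Function using (id; _∘_)
open import Function.Bundles using (_⇔_; mk⇔; Equivalence)
open import Relation.Nullary using (¬_; yes; no)
open import Relation.Binary.Definitions using (DecidableEquality; Symmetric)
open import Relation.Binary.PropositionalEquality using (_≡_; _≢_; refl; cong; subst)
open import Relation.Binary.Construct.Closure.ReflexiveTransitive using (Star; ε; _◅_; _◅◅_)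

module Walks {V : Set} (_≟_ : DecidableEquality V) (E : V → V → Set) (E-sym : Symmetric E) where

  AllV : (V → Set) → ∀ {x y} → Star E x y → Set
  AllV P {x} ε = P x
  AllV P {x} (e ◅ p) = P x × AllV P p

  Avoids : V → ∀ {x y} → Star E x y → Set
  Avoids z = AllV (z ≢_)

  Simple : ∀ {x y} → Star E x y → Set
  Simple ε = ⊤
  Simple {x} (e ◅ p) = Avoids x p × Simple p

  -- every vertex of r is a vertex of p
  _⊆ᵥ_ : ∀ {x y u v} → Star E x y → Star E u v → Set₁
  r ⊆ᵥ p = ∀ {P} → AllV P p → AllV P r

  SimpleWithin : ∀ {u v} → Star E u v → V → V → Set₁
  SimpleWithin p x y = Σ (Star E x y) λ r → Simple r × r ⊆ᵥ p

  allV-first : ∀ {P x y} (p : Star E x y) → AllV P p → P x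
  allV-first ε a = a
  allV-first (e ◅ p) (a , _) = a

  allV-last : ∀ {P x y} (p : Star E x y) → AllV P p → P y
  allV-last ε a = a
  allV-last (e ◅ p) (_ , as) = allV-last p as

  allV-zipWith : ∀ {P Q R : V → Set} → (∀ {z} → P z → Q z → R z) →
                 ∀ {x y} (p : Star E x y) → AllV P p → AllV Q p → AllV R p
  allV-zipWith f ε a b = f a b
  allV-zipWith f (e ◅ p) (a , as) (b , bs) = f a b , allV-zipWith f p as bs

  allV-◅◅ : ∀ {P x y z} (p : Star E x y) (q : Star E y z) → AllV P p → AllV P q → AllV P (p ◅◅ q)
  allV-◅◅ ε q _ b = b
  allV-◅◅ (e ◅ p) q (a , as) b = a , allV-◅◅ p q as b

  reverse : ∀ {x y} → Star E x y → Star E y x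
  reverse ε = ε
  reverse (e ◅ p) = reverse p ◅◅ (E-sym e ◅ ε)

  allV-reverse : ∀ {P x y} (p : Star E x y) → AllV P p → AllV P (reverse p)
  allV-reverse ε a = a
  allV-reverse (e ◅ p) (a , as) = allV-◅◅ (reverse p) _ (allV-reverse p as) (allV-first p as , a)

  suffixFrom : ∀ z {u y} (p : Star E u y) → Simple p → SimpleWithin p z y ⊎ Avoids z p
  suffixFrom z {u} ε _ with z ≟ u
  ... | yes refl = inj₁ (ε , _ , id)
  ... | no z≢u = inj₂ z≢u
  suffixFrom z {u} (e ◅ p) (u∉p , sp) with z ≟ u
  ... | yes refl = inj₁ (e ◅ p , (u∉p , sp) , id)
  ... | no z≢u with suffixFrom z p sp
  ...   | inj₁ (r , r-simple , r⊆p) = inj₁ (r , r-simple , λ a → r⊆p (proj₂ a))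
  ...   | inj₂ z∉p = inj₂ (z≢u , z∉p)

  simplify : ∀ {x y} (p : Star E x y) → SimpleWithin p x y
  simplify ε = ε , _ , id
  simplify {x} (e ◅ p) with simplify p
  ... | p′ , sp′ , p′⊆p with suffixFrom x p′ sp′
  ...   | inj₁ (r , r-simple , r⊆p′) = r , r-simple , λ a → r⊆p′ (p′⊆p (proj₂ a))
  ...   | inj₂ x∉p′ = e ◅ p′ , (x∉p′ , sp′) , λ a → proj₁ a , p′⊆p (proj₂ a)

  vertices : ∀ {x y} → Star E x y → List V
  vertices {x} ε = [ x ]
  vertices {x} (e ◅ p) = x ∷ vertices p

  -- Literally Defs.HasCycle, so that correctness of a net yields ¬ Cyclic for its switching graphs.
  Cyclic : Set
  Cyclic = Σ V λ x → Σ (List V) λ ws →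
    (2 ≤ length ws) × AllPairs _≢_ (x ∷ ws) × Linked E (x ∷ ws ++ [ x ])

  private
    allV⇒All : ∀ {P x y} (p : Star E x y) → AllV P p → All P (vertices p)
    allV⇒All ε a = a ∷ []
    allV⇒All (e ◅ p) (a , as) = a ∷ allV⇒All p as

    simple⇒AllPairs : ∀ {x y} (p : Star E x y) → Simple p → AllPairs _≢_ (vertices p)
    simple⇒AllPairs ε _ = [] ∷ []
    simple⇒AllPairs (e ◅ p) (x∉p , sp) = allV⇒All p x∉p ∷ simple⇒AllPairs p sp

    linked-◅ : ∀ {x y z} (p : Star E x y) → E y z → Linked E (vertices p ++ [ z ])
    linked-◅ ε e = e ∷ [-]
    linked-◅ (e ◅ ε) e′ = e ∷ e′ ∷ [-]
    linked-◅ (e ◅ (e₂ ◅ p)) e′ = e ∷ linked-◅ (e₂ ◅ p) e′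

    vertices-nonempty : ∀ {x y} (p : Star E x y) → 1 ≤ length (vertices p)
    vertices-nonempty ε = s≤s z≤n
    vertices-nonempty (_ ◅ _) = s≤s z≤n

  closeCycle : ∀ {x a b} → E x a → E x b → a ≢ b →
               (r : Star E a b) → Simple r → Avoids x r → Cyclic
  closeCycle _ _ a≢b ε _ _ = ⊥-elim (a≢b refl)
  closeCycle {x} xa xb _ (e ◅ r) r-simple x∉r =
    x , vertices (e ◅ r) , s≤s (vertices-nonempty r) ,
    allV⇒All (e ◅ r) x∉r ∷ simple⇒AllPairs (e ◅ r) r-simple ,
    xa ∷ linked-◅ (e ◅ r) (E-sym xb)

  -- Two simple walks that part ways at a vertex close a cycle through it.
  simple-unique : ¬ Cyclic → ∀ {x y} (p q : Star E x y) → Simple p → Simple q → p ⊆ᵥ q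
  simple-unique _ ε q _ _ aq = allV-first q aq
  simple-unique _ (e ◅ p) ε (x∉p , _) _ _ = ⊥-elim (allV-last p x∉p refl)
  simple-unique acyclic (_◅_ {j = a} xa p) (_◅_ {j = b} xb q) (x∉p , sp) (x∉q , sq) aq with a ≟ b
  ... | yes refl = proj₁ aq , simple-unique acyclic p q sp sq (proj₂ aq)
  ... | no a≢b with simplify (p ◅◅ reverse q)
  ...   | r , r-simple , r⊆pq = ⊥-elim (acyclic (closeCycle xa xb a≢b r r-simple
                            (r⊆pq (allV-◅◅ p (reverse q) x∉p (allV-reverse q x∉q)))))

decEqPos : ∀ {F} → DecidableEquality (Pos F)
decEqPos here here = yes refl
decEqPos here (inl q) = no λ ()
decEqPos here (inr q) = no λ ()
decEqPos (inl p) here = no λ ()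
decEqPos (inl p) (inl q) with decEqPos p q
... | yes refl = yes refl
... | no p≢q = no λ { refl → p≢q refl }
decEqPos (inl p) (inr q) = no λ ()
decEqPos (inr p) here = no λ ()
decEqPos (inr p) (inl q) = no λ ()
decEqPos (inr p) (inr q) with decEqPos p q
... | yes refl = yes refl
... | no p≢q = no λ { refl → p≢q refl }

decEqRPos : ∀ {r} → DecidableEquality (RPos r)
decEqRPos (cpos p) (cpos q) with decEqPos p q
... | yes refl = yes refl
... | no p≢q = no λ { refl → p≢q refl }
decEqRPos cutNode cutNode = yes refl
decEqRPos cutNode (cutL q) = no λ ()
decEqRPos cutNode (cutR q) = no λ ()
decEqRPos (cutL p) cutNode = no λ ()
decEqRPos (cutL p) (cutL q) with decEqPos p q
... | yes refl = yes refl
... | no p≢q = no λ { refl → p≢q refl }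
decEqRPos (cutL p) (cutR q) = no λ ()
decEqRPos (cutR p) cutNode = no λ ()
decEqRPos (cutR p) (cutL q) = no λ ()
decEqRPos (cutR p) (cutR q) with decEqPos p q
... | yes refl = yes refl
... | no p≢q = no λ { refl → p≢q refl }

ChildP-parent-unique : ∀ {F s s′} {p p′ q : Pos F} → ChildP s p q → ChildP s′ p′ q → p ≡ p′
ChildP-parent-unique cl cl = refl
ChildP-parent-unique cr cr = refl
ChildP-parent-unique cl (sl ())
ChildP-parent-unique cr (sr ())
ChildP-parent-unique (sl ()) cl
ChildP-parent-unique (sr ()) cr
ChildP-parent-unique (sl c) (sl c′) = cong inl (ChildP-parent-unique c c′)
ChildP-parent-unique (sr c) (sr c′) = cong inr (ChildP-parent-unique c c′)

ChildR-parent-unique : ∀ {r s s′} {p p′ q : RPos r} → ChildR s p q → ChildR s′ p′ q → p ≡ p′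
ChildR-parent-unique (inC c) (inC c′) = cong cpos (ChildP-parent-unique c c′)
ChildR-parent-unique cutCL cutCL = refl
ChildR-parent-unique cutCR cutCR = refl
ChildR-parent-unique cutCL (inCL ())
ChildR-parent-unique cutCR (inCR ())
ChildR-parent-unique (inCL ()) cutCL
ChildR-parent-unique (inCR ()) cutCR
ChildR-parent-unique (inCL c) (inCL c′) = cong cutL (ChildP-parent-unique c c′)
ChildR-parent-unique (inCR c) (inCR c′) = cong cutR (ChildP-parent-unique c c′)

module _ (π : PreNet) where

  private
    _∈_ : NodeOf π → Subset π → Set
    x ∈ S = _∈ₛ_ π x S

    _⊆_ : Subset π → Subset π → Set
    S ⊆ S′ = _⊆ₛ_ π S S′

  Ch-parent-unique : ∀ {s s′ x y z} → Ch π s y x → Ch π s′ z x → y ≡ z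
  Ch-parent-unique (child c) (child c′) = cong (_ ,_) (ChildR-parent-unique c c′)

  decEqNode : DecidableEquality (NodeOf π)
  decEqNode = ≡-dec Fin._≟_ decEqRPos

  _∩_ _∪_ : Subset π → Subset π → Subset π
  (S ∩ S′) x = S x ∧ S′ x
  (S ∪ S′) x = S x ∨ S′ x

  ∈-∩ : ∀ S S′ {z} → z ∈ (S ∩ S′) ⇔ (z ∈ S × z ∈ S′)
  ∈-∩ _ _ = T-∧

  ∈-∪ : ∀ S S′ {z} → z ∈ (S ∪ S′) ⇔ (z ∈ S ⊎ z ∈ S′)
  ∈-∪ _ _ = T-∨

  open Equivalence

  Edge-endpoints : ∀ {S sw x y} → Edge π S sw x y → x ∈ S × y ∈ S
  Edge-endpoints (inj₁ (inj₁ (_ , _ , x∈ , y∈ , _))) = x∈ , y∈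
  Edge-endpoints (inj₁ (inj₂ (_ , _ , _ , x∈ , y∈))) = x∈ , y∈
  Edge-endpoints (inj₂ (inj₁ (_ , _ , y∈ , x∈ , _))) = x∈ , y∈
  Edge-endpoints (inj₂ (inj₂ (_ , _ , _ , y∈ , x∈))) = x∈ , y∈

  Edge-transfer : ∀ {S S′ sw x y} → Edge π S sw x y → x ∈ S′ → y ∈ S′ → Edge π S′ sw x y
  Edge-transfer (inj₁ (inj₁ (s , c , _ , _ , f))) x∈ y∈ = inj₁ (inj₁ (s , c , x∈ , y∈ , f))
  Edge-transfer (inj₁ (inj₂ (l , e₁ , e₂ , _ , _))) x∈ y∈ = inj₁ (inj₂ (l , e₁ , e₂ , x∈ , y∈))
  Edge-transfer (inj₂ (inj₁ (s , c , _ , _ , f))) x∈ y∈ = inj₂ (inj₁ (s , c , y∈ , x∈ , f))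
  Edge-transfer (inj₂ (inj₂ (l , e₁ , e₂ , _ , _))) x∈ y∈ = inj₂ (inj₂ (l , e₁ , e₂ , y∈ , x∈))

  Star-Edge-mono : ∀ {S S′ sw x y} → S ⊆ S′ → Star (Edge π S sw) x y → Star (Edge π S′ sw) x y
  Star-Edge-mono S⊆S′ ε = ε
  Star-Edge-mono S⊆S′ (e ◅ p) =
    Edge-transfer e (S⊆S′ _ (proj₁ (Edge-endpoints e))) (S⊆S′ _ (proj₂ (Edge-endpoints e)))
    ◅ Star-Edge-mono S⊆S′ p

  Correct-full⇒acyclic : ∀ {S} sw → Correct π (full π) → ¬ HasCycle π S sw
  Correct-full⇒acyclic sw cf (x , ws , len , distinct , cycle) =
    proj₂ (cf sw) (x , ws , len , distinct , Linked.map (λ e → Edge-transfer e tt tt) cycle)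

  module _ (sw : Switching π) where
    open Walks decEqNode (Edge π (full π) sw) swap

    walk-toFull : ∀ {S x y} → Star (Edge π S sw) x y → x ∈ S →
                  Σ (Star (Edge π (full π) sw) x y) (AllV (_∈ S))
    walk-toFull ε x∈ = ε , x∈
    walk-toFull (e ◅ p) x∈ with walk-toFull p (proj₂ (Edge-endpoints e))
    ... | q , q⊆S = Edge-transfer e tt tt ◅ q , x∈ , q⊆S

    walk-fromFull : ∀ {S x y} (p : Star (Edge π (full π) sw) x y) → AllV (_∈ S) p →
                    Star (Edge π S sw) x y
    walk-fromFull ε _ = ε
    walk-fromFull (e ◅ p) (x∈ , p⊆S) = Edge-transfer e x∈ (allV-first p p⊆S) ◅ walk-fromFull p p⊆S

  module _ (cf : Correct π (full π)) {S S′ : Subset π} (cS : Correct π S) (cS′ : Correct π S′) where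

    -- The simple paths from x to y inside S and inside S′ coincide.
    Correct-∩ : Correct π (S ∩ S′)
    Correct-∩ sw = connected , Correct-full⇒acyclic sw cf
      where
      open Walks decEqNode (Edge π (full π) sw) swap
      connected : Connected π (S ∩ S′) sw
      connected x y x∈ y∈ with to (∈-∩ S S′) x∈ | to (∈-∩ S S′) y∈
      ... | x∈S , x∈S′ | y∈S , y∈S′
        with walk-toFull sw (proj₁ (cS sw) x y x∈S y∈S) x∈S | walk-toFull sw (proj₁ (cS′ sw) x y x∈S′ y∈S′) x∈S′
      ... | p , p⊆S | q , q⊆S′ with simplify p | simplify q
      ... | p′ , p′-simple , p′⊆p | q′ , q′-simple , q′⊆q =
        walk-fromFull sw p′ (allV-zipWith (λ a b → from (∈-∩ S S′) (a , b)) p′ (p′⊆p p⊆S)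
          (simple-unique (Correct-full⇒acyclic sw cf) p′ q′ p′-simple q′-simple (q′⊆q q⊆S′)))

    Correct-∪ : ∀ {w} → w ∈ S → w ∈ S′ → Correct π (S ∪ S′)
    Correct-∪ {w} w∈S w∈S′ sw = connected , Correct-full⇒acyclic sw cf
      where
      toW : ∀ {x} → x ∈ S ⊎ x ∈ S′ → Star (Edge π (S ∪ S′) sw) x w
      toW (inj₁ x∈) = Star-Edge-mono (λ _ → from (∈-∪ S S′) ∘ inj₁) (proj₁ (cS sw) _ w x∈ w∈S)
      toW (inj₂ x∈) = Star-Edge-mono (λ _ → from (∈-∪ S S′) ∘ inj₂) (proj₁ (cS′ sw) _ w x∈ w∈S′)
      fromW : ∀ {y} → y ∈ S ⊎ y ∈ S′ → Star (Edge π (S ∪ S′) sw) w y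
      fromW (inj₁ y∈) = Star-Edge-mono (λ _ → from (∈-∪ S S′) ∘ inj₁) (proj₁ (cS sw) w _ w∈S y∈)
      fromW (inj₂ y∈) = Star-Edge-mono (λ _ → from (∈-∪ S S′) ∘ inj₂) (proj₁ (cS′ sw) w _ w∈S′ y∈)
      connected : Connected π (S ∪ S′) sw
      connected x y x∈ y∈ = toW (to (∈-∪ S S′) x∈) ◅◅ fromW (to (∈-∪ S S′) y∈)

  Subprenet-∩ : ∀ {S S′} → Subprenet π S → Subprenet π S′ → Subprenet π (S ∩ S′)
  Subprenet-∩ {S} {S′} (ch , lk) (ch′ , lk′) =
    (λ s x y c x∈ → from (∈-∩ S S′) (map× (ch s x y c) (ch′ s x y c) (to (∈-∩ S S′) x∈))) ,
    (λ l x∈ → from (∈-∩ S S′) (map× (lk l) (lk′ l) (to (∈-∩ S S′) x∈)))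

  Subprenet-∪ : ∀ {S S′} → Subprenet π S → Subprenet π S′ → Subprenet π (S ∪ S′)
  Subprenet-∪ {S} {S′} (ch , lk) (ch′ , lk′) =
    (λ s x y c x∈ → from (∈-∪ S S′) (map⊎ (ch s x y c) (ch′ s x y c) (to (∈-∪ S S′) x∈))) ,
    (λ l x∈ → from (∈-∪ S S′) (map⊎ (lk l) (lk′ l) (to (∈-∪ S S′) x∈)))

  Subnet-∩ : ∀ {S S′} → Subnet π S → Subnet π S′ → Subnet π (S ∩ S′)
  Subnet-∩ (sS , cS , cf) (sS′ , cS′ , _) = Subprenet-∩ sS sS′ , Correct-∩ cf cS cS′ , cf

  Subnet-∪ : ∀ {S S′ w} → w ∈ S → w ∈ S′ → Subnet π S → Subnet π S′ → Subnet π (S ∪ S′)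
  Subnet-∪ w∈S w∈S′ (sS , cS , cf) (sS′ , cS′ , _) =
    Subprenet-∪ sS sS′ , Correct-∪ cf cS cS′ w∈S w∈S′ , cf

  kingdom-⊆-subnet : ∀ {B kB S} → IsKingdom π B kB → Subnet π S → B ∈ S → kB ⊆ S
  kingdom-⊆-subnet {B} {kB} {S} (netK , (B∈K , fmB , B-top) , minimal) netS B∈S x x∈K =
    proj₁ (to (∈-∩ S kB) (minimal (S ∩ kB) (Subnet-∩ netS netK) door x x∈K))
    where
    door : Door π (S ∩ kB) B
    door = from (∈-∩ S kB) (B∈S , B∈K) , fmB , λ s y c y∈ → B-top s y c (proj₂ (to (∈-∩ S kB) y∈))

  subnet-⊆-empire : ∀ {A′ eA′ S w} → IsEmpire π A′ eA′ → Subnet π S →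
                    w ∈ eA′ → w ∈ S → (∀ s y → Ch π s y A′ → ¬ y ∈ S) → S ⊆ eA′
  subnet-⊆-empire {A′} {eA′} {S} (netE , (A′∈E , fmA′ , A′-top) , maximal) netS w∈E w∈S A′-topS x x∈S =
    maximal (eA′ ∪ S) (Subnet-∪ w∈E w∈S netE netS) door x (from (∈-∪ eA′ S) (inj₂ x∈S))
    where
    door : Door π (eA′ ∪ S) A′
    door = from (∈-∪ eA′ S) (inj₁ A′∈E) , fmA′ ,
           λ s y c y∈ → [ A′-top s y c , A′-topS s y c ]′ (to (∈-∪ eA′ S) y∈)

lemma2p28 : (π : PreNet) → Correct π (full π) →
    (A A' B B' : NodeOf π) →
    IsFm (lab π A) → IsFm (lab π A') → IsFm (lab π B) → IsFm (lab π B') →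
    A ≢ B → ImmSub π A' A → ImmSub π B' B →
    (eA' kB : Subset π) → IsEmpire π A' eA' → IsKingdom π B kB →
    _∈ₛ_ π B' eA' →
    ((¬ (_∈ₛ_ π B eA')) ⇔ (_∈ₛ_ π A kB))
lemma2p28 π _ A A' B B' _ _ _ _ _ (sa , A→A') (sb , B→B') eA' kB
  empire@(netE , (_ , _ , A'-top) , _) kingdom@(netK@((kB-closed , _) , _) , (B∈kB , _) , _) B'∈eA' =
  mk⇔ B∉eA'⇒A∈kB A∈kB⇒B∉eA'
  where
  A∈kB⇒B∉eA' : _∈ₛ_ π A kB → ¬ _∈ₛ_ π B eA'
  A∈kB⇒B∉eA' A∈kB B∈eA' = A'-top sa A A→A' (kingdom-⊆-subnet π kingdom netE B∈eA' A A∈kB)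

  B∉eA'⇒A∈kB : ¬ _∈ₛ_ π B eA' → _∈ₛ_ π A kB
  B∉eA'⇒A∈kB B∉eA' with T? (kB A)
  ... | yes A∈kB = A∈kB
  ... | no A∉kB = ⊥-elim (B∉eA' (kB⊆eA' B B∈kB))
    where
    no-parent-of-A' : ∀ s y → Ch π s y A' → ¬ _∈ₛ_ π y kB
    no-parent-of-A' s y y→A' = subst (λ z → ¬ _∈ₛ_ π z kB) (Ch-parent-unique π A→A' y→A') A∉kB

    kB⊆eA' : _⊆ₛ_ π kB eA'
    kB⊆eA' = subnet-⊆-empire π empire netK B'∈eA' (kB-closed sb B B' B→B' B∈kB) no-parent-of-A'
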